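{- Let $G$ be a finite simple graph and let $I$ be a maximal irredundant set of $G$ of minimum cardinality. Let $U$ be the set of vertices of $G$ having no neighbor in $I$ and not in $I$; let $A$ be the set of vertices of $I$ having at least one neighbor in $I$; let $Q$ be the set of $q \in A$ such that $PN(q,I) \not\subseteq N_G(u)$ for every $u \in U$; and let $B = A \setminus Q$. Let $N = \{a_1,\dots,a_{|N|}\} \subseteq B$ be an inclusion-maximal subset of $B$ such that every $x \in N$ satisfies: $PN(x,I)$ induces a clique, or for each $x' \in PN(x,I)$ there is $y \in N$ with $x' \succ PN(y,I)$. For each $i$ choose $a_i' \in PN(a_i,I)$ and let $\hat N = \{a_1',\dots,a_{|N|}'\}$. Then $\hat N \succ \bigcup_{i=1}^{|N|} PN(a_i,I)$.
   Context: For $S \subseteq V(G)$ and $x \in S$, the private neighborhood is $PN(x,S) = N_G[x] \setminus N_G[S \setminus \{x\}]$. A set $I$ is irredundant if $PN(x,I) \neq \emptyset$ for all $x \in I$, and maximal irredundant if no proper superset is irredundant. For vertex sets $S,R$, $S \succ R$ ("$S$ dominates $R$") means every vertex of $R \setminus S$ is adjacent to some vertex of $S$; for a single vertex $s$, $s \succ R$ means $\{s\} \succ R$. -}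

module Defs where

open import Data.Nat using (ℕ; _≤_)
open import Data.Bool using (Bool; T; false)
open import Data.Fin using (Fin)
open import Data.Fin.Subset using (Subset; _∈_; _∉_; _⊆_; _⊂_; ∣_∣)
open import Data.Product using (Σ; ∃; _×_; _,_)
open import Data.Sum using (_⊎_)
open import Relation.Nullary using (¬_)
open import Relation.Binary.PropositionalEquality using (_≡_; _≢_)

record Graph : Set where
  field
    n     : ℕ
    adj   : Fin n → Fin n → Bool
    sym   : ∀ u v → adj u v ≡ adj v u
    irrefl : ∀ v → adj v v ≡ false

module _ (G : Graph) where
  open Graph G

  V : Set
  V = Fin n

  Adj : V → V → Set
  Adj u v = T (adj u v)

  InClosedNbhd : V → V → Set
  InClosedNbhd x v = v ≡ x ⊎ Adj x v

  InPN : V → Subset n → V → Set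
  InPN x S v = InClosedNbhd x v × (∀ y → y ∈ S → y ≢ x → ¬ InClosedNbhd y v)

  Irredundant : Subset n → Set
  Irredundant S = ∀ x → x ∈ S → ∃ λ v → InPN x S v

  MaximalIrredundant : Subset n → Set
  MaximalIrredundant S = Irredundant S × ¬ (∃ λ J → S ⊂ J × Irredundant J)

  MinMaximalIrredundant : Subset n → Set
  MinMaximalIrredundant I =
    MaximalIrredundant I × (∀ J → MaximalIrredundant J → ∣ I ∣ ≤ ∣ J ∣)

  Dominates : (V → Set) → (V → Set) → Set
  Dominates S R = ∀ v → R v → ¬ S v → ∃ λ s → S s × Adj s v

  VDominates : V → (V → Set) → Set
  VDominates s R = Dominates (λ w → w ≡ s) R

  module _ (I : Subset n) where
    InU : V → Set
    InU u = u ∉ I × (∀ y → y ∈ I → ¬ Adj u y)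

    InA : V → Set
    InA a = a ∈ I × ∃ λ y → y ∈ I × Adj a y

    InQ : V → Set
    InQ q = InA q × (∀ u → InU u → ¬ (∀ v → InPN q I v → Adj u v))

    InB : V → Set
    InB b = InA b × ¬ InQ b

    PNClique : V → Set
    PNClique x = ∀ v w → InPN x I v → InPN x I w → v ≢ w → Adj v w

    GoodN : Subset n → Set
    GoodN N = (∀ x → x ∈ N → InB x)
            × (∀ x → x ∈ N →
                 PNClique x
                 ⊎ (∀ x' → InPN x I x' →
                      ∃ λ y → y ∈ N × VDominates x' (InPN y I)))

    MaximalGoodN : Subset n → Set
    MaximalGoodN N = GoodN N × (∀ N' → GoodN N' → N ⊆ N' → N' ⊆ N)

-- Let v ∈ PN(x,I) with x ∈ N be no chosen representative. If PN(x,I) is a clique,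
-- v is adjacent to the representative of x. Otherwise some y ∈ N has v ≻ PN(y,I);
-- the representative of y lies in PN(y,I) and differs from v, hence is adjacent to v.
module Submission where

open import Defs
open import Data.Fin using (Fin)
open import Data.Fin.Subset using (Subset; _∈_)
open import Data.Product using (∃; _×_; _,_)
open import Data.Sum using (_⊎_; inj₁; inj₂)
open import Data.Bool using (T)
open import Relation.Nullary using (¬_)
open import Relation.Binary.PropositionalEquality using (_≡_; _≢_; refl; sym; subst)

module _ (G : Graph) where
  open Graph G using (n)

  Adj-sym : ∀ {u v} → Adj G u v → Adj G v u
  Adj-sym {u} {v} = subst T (Graph.sym G u v)

  VDominates⇒Adj : ∀ {s R v} → VDominates G s R → R v → v ≢ s → Adj G v s
  VDominates⇒Adj s≻R v∈R v≢s with s≻R _ v∈R v≢s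
  ... | _ , refl , s~v = Adj-sym s~v

  module _ (I N : Subset n) (f : V G → V G) (f∈PN : ∀ x → x ∈ N → InPN G x I (f x)) where

    Representative : V G → Set
    Representative v = ∃ λ x → x ∈ N × v ≡ f x

    InUnionPN : V G → Set
    InUnionPN v = ∃ λ x → x ∈ N × InPN G x I v

    CliqueOrDominatedPN : Set
    CliqueOrDominatedPN = ∀ x → x ∈ N →
             PNClique G I x
             ⊎ (∀ x' → InPN G x I x' → ∃ λ y → y ∈ N × VDominates G x' (InPN G y I))

    ¬Representative⇒≢ : ∀ {v z} → ¬ Representative v → z ∈ N → f z ≢ v
    ¬Representative⇒≢ v∉R z∈N fz≡v = v∉R (_ , z∈N , sym fz≡v)

    representatives-dominate-PN : CliqueOrDominatedPN → Dominates G Representative InUnionPN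
    representatives-dominate-PN good v (x , x∈N , v∈PNx) v∉R with good x x∈N
    ... | inj₁ clique =
      f x , (x , x∈N , refl) , clique (f x) v (f∈PN x x∈N) v∈PNx (¬Representative⇒≢ v∉R x∈N)
    ... | inj₂ dominated with dominated v v∈PNx
    ... | y , y∈N , v≻PNy =
      f y , (y , y∈N , refl) , VDominates⇒Adj v≻PNy (f∈PN y y∈N) (¬Representative⇒≢ v∉R y∈N)

lemma1 : (G : Graph) (I : Subset (Graph.n G)) → MinMaximalIrredundant G I
       → (N : Subset (Graph.n G)) → MaximalGoodN G I N
       → (f : Fin (Graph.n G) → Fin (Graph.n G))
       → (∀ x → x ∈ N → InPN G x I (f x))
       → Dominates G (λ v → ∃ λ x → x ∈ N × v ≡ f x)
                     (λ v → ∃ λ x → x ∈ N × InPN G x I v)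
lemma1 G I _ N ((_ , good) , _) f f∈PN = representatives-dominate-PN G I N f f∈PN good
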